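{- Let $T$ be a non-trivial cubic Halin tripole such that $T=T_1+T_2$. Then $P(T)=P(T_1)\oplus P(T_2)$.
   Context: A Halin graph is obtained from a plane tree with at least three leaves and no vertex of degree $2$ by adding a cycle through all its leaves in the cyclic order of the embedding; it is cubic if all non-leaf tree vertices have degree $3$. A tripole is a graph with three semi-edges (edges having only one endpoint). For a tree edge $e=uw$ of a cubic Halin graph $H$, deleting $e$ from the tree splits it into two subtrees; let $X$ be the vertex set of the one containing $u$, $Y=V(H)\setminus X$. The cubic Halin tripole is $H[X]$ together with the three edges joining $X$ and $Y$ (namely $e$ and two cycle edges), kept as semi-edges attached only to their endpoints in $X$, with inherited plane embedding. Root semi-edge $r=e$, root vertex $r^*=u$; the other semi-edges $x,y$ are named so that $r,x,y$ appear in this order along the outer face in a fixed orientation, with endpoints $x^*,y^*$; extended boundary $\partial T=(r,r^*,x,x^*,y,y^*)$. The tripole is trivial if $|X|=1$. Composition: for tripoles $T_1,T_2$ with extended boundaries $(r_i,r_i^*,x_i,x_i^*,y_i,y_i^*)$, $T_1+T_2$ has vertex set $V(T_1)\cup V(T_2)\cup\{r^*\}$ ($r^*$ new), obtained by merging semi-edges $y_1$ and $x_2$ into an edge $y_1^*x_2^*$, turning $r_1,r_2$ into edges $r_1^*r^*,r_2^*r^*$, and adding a new semi-edge $r$ at $r^*$; its extended boundary is $(r,r^*,x_1,x_1^*,y_2,y_2^*)$. A total $4$-coloring of a tripole is an assignment of colors from $\{0,1,2,3\}$ to vertices, edges and semi-edges such that adjacent vertices get distinct colors, any two edges/semi-edges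 sharing an endpoint get distinct colors, and each edge/semi-edge gets a color different from its endpoint(s). Let $S=\{(a,b,c,d,e,f)\in\{0,1,2,3\}^6: a\ne b, c\ne d, e\ne f\}$. The palette $P(T)\subseteq S$ is the set of sextuples $(\varphi(r),\varphi(r^*),\varphi(x),\varphi(x^*),\varphi(y),\varphi(y^*))$ over all total $4$-colorings $\varphi$ of $T$. Sextuples $s_1=(a_1,b_1,c_1,d_1,e_1,f_1)$, $s_2=(a_2,b_2,c_2,d_2,e_2,f_2)\in S$ are composable if $e_1=c_2$, $|\{e_1,f_1,c_2,d_2\}|=3$, $a_1\ne a_2$, and $|\{a_1,b_1,a_2,b_2\}|\le 3$. Composable $s_1,s_2$ yield $s=(a,b,c,d,e,f)\in S$ if $c=c_1$, $d=d_1$, $e=e_2$, $f=f_2$, $b\notin\{a_1,b_1,a_2,b_2\}$, and $a\notin\{b,a_1,a_2\}$. Let $s_1\oplus s_2$ be the set of all $s\in S$ yielded by $s_1,s_2$ if they are composable, and $\emptyset$ otherwise. For $P_1,P_2\subseteq S$, $P_1\oplus P_2=\bigcup_{s_1\in P_1,s_2\in P_2} s_1\oplus s_2$. -}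

module Defs where

open import Data.Nat using (ℕ; zero; suc; _+_)
open import Data.Fin using (Fin; zero; suc; _↑ˡ_; _↑ʳ_; splitAt)
open import Data.Fin.Properties using (_≟_)
open import Data.List using (List; []; _∷_; filter; length)
open import Data.List.Base using (allFin)
open import Data.List.Membership.Propositional using (_∈_; _∉_)
open import Data.List.Membership.DecPropositional (_≟_ {4}) using (_∈?_)
open import Data.Product using (Σ; ∃; _×_; _,_; proj₁; proj₂)
open import Data.Sum using (_⊎_; inj₁; inj₂)
open import Relation.Binary.PropositionalEquality using (_≡_; _≢_)

Color : Set
Color = Fin 4

-- The order (r, x, y) encodes the orientation
-- along the outer face.

data Semi : Set where
  r x y : Semi

record Tripole : Set where
  field
    nV   : ℕ
    nE   : ℕ
    edge : Fin nE → Fin nV × Fin nV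
    semi : Semi → Fin nV
open Tripole public

Item : Tripole → Set
Item T = Fin (nE T) ⊎ Semi

Incident : (T : Tripole) → Item T → Fin (nV T) → Set
Incident T (inj₁ i) v = proj₁ (edge T i) ≡ v ⊎ proj₂ (edge T i) ≡ v
Incident T (inj₂ s) v = semi T s ≡ v

record TotalColoring (T : Tripole) : Set where
  field
    vcol : Fin (nV T) → Color
    icol : Item T → Color
    vertex-proper : ∀ i → vcol (proj₁ (edge T i)) ≢ vcol (proj₂ (edge T i))
    item-proper   : ∀ a b v → a ≢ b → Incident T a v → Incident T b v →
                    icol a ≢ icol b
    incid-proper  : ∀ a v → Incident T a v → icol a ≢ vcol v
open TotalColoring public

record Sext : Set where
  constructor sext
  field
    c₁ c₂ c₃ c₄ c₅ c₆ : Color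

InS : Sext → Set
InS (sext a b c d e f) = a ≢ b × c ≢ d × e ≢ f

-- (φ(r), φ(r*), φ(x), φ(x*), φ(y), φ(y*))
boundary : {T : Tripole} → TotalColoring T → Sext
boundary {T} φ =
  sext (icol φ (inj₂ r)) (vcol φ (semi T r))
       (icol φ (inj₂ x)) (vcol φ (semi T x))
       (icol φ (inj₂ y)) (vcol φ (semi T y))

-- subsets of S are represented as predicates on sextuples
Palette : Tripole → Sext → Set
Palette T s = Σ (TotalColoring T) λ φ → boundary φ ≡ s

card : List Color → ℕ
card l = length (filter (_∈? l) (allFin 4))

Composable : Sext → Sext → Set
Composable (sext a₁ b₁ c₁ d₁ e₁ f₁) (sext a₂ b₂ c₂ d₂ e₂ f₂) =
  e₁ ≡ c₂ × card (e₁ ∷ f₁ ∷ c₂ ∷ d₂ ∷ []) ≡ 3 × a₁ ≢ a₂ ×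
  Data.Nat._≤_ (card (a₁ ∷ b₁ ∷ a₂ ∷ b₂ ∷ [])) 3

Yields : Sext → Sext → Sext → Set
Yields (sext a₁ b₁ c₁ d₁ e₁ f₁) (sext a₂ b₂ c₂ d₂ e₂ f₂) (sext a b c d e f) =
  c ≡ c₁ × d ≡ d₁ × e ≡ e₂ × f ≡ f₂ ×
  b ∉ (a₁ ∷ b₁ ∷ a₂ ∷ b₂ ∷ []) × a ∉ (b ∷ a₁ ∷ a₂ ∷ [])

_⊕_ : (Sext → Set) → (Sext → Set) → Sext → Set
(P₁ ⊕ P₂) s = ∃ λ s₁ → ∃ λ s₂ →
  P₁ s₁ × P₂ s₂ × InS s₁ × InS s₂ × Composable s₁ s₂ × InS s × Yields s₁ s₂ s

_≐_ : (Sext → Set) → (Sext → Set) → Set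
P ≐ Q = ∀ s → (P s → Q s) × (Q s → P s)

-- Composition T₁ + T₂ (new root vertex r* is vertex zero)

module Compose (T₁ T₂ : Tripole) where
  n₁ = nV T₁
  n₂ = nV T₂
  m₁ = nE T₁
  m₂ = nE T₂

  emb₁ : Fin n₁ → Fin (suc (n₁ + n₂))
  emb₁ v = suc (v ↑ˡ n₂)

  emb₂ : Fin n₂ → Fin (suc (n₁ + n₂))
  emb₂ v = suc (n₁ ↑ʳ v)

  old : Fin (m₁ + m₂) → Fin (suc (n₁ + n₂)) × Fin (suc (n₁ + n₂))
  old i with splitAt m₁ i
  ... | inj₁ j = emb₁ (proj₁ (edge T₁ j)) , emb₁ (proj₂ (edge T₁ j))
  ... | inj₂ j = emb₂ (proj₁ (edge T₂ j)) , emb₂ (proj₂ (edge T₂ j))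

  edges : Fin (3 + (m₁ + m₂)) → Fin (suc (n₁ + n₂)) × Fin (suc (n₁ + n₂))
  edges zero = emb₁ (semi T₁ y) , emb₂ (semi T₂ x)
  edges (suc zero) = emb₁ (semi T₁ r) , zero
  edges (suc (suc zero)) = emb₂ (semi T₂ r) , zero
  edges (suc (suc (suc i))) = old i

  semis : Semi → Fin (suc (n₁ + n₂))
  semis r = zero
  semis x = emb₁ (semi T₁ x)
  semis y = emb₂ (semi T₂ y)

  result : Tripole
  result = record { nV = suc (n₁ + n₂) ; nE = 3 + (m₁ + m₂)
                  ; edge = edges ; semi = semis }

_+ᵀ_ : Tripole → Tripole → Tripole
T₁ +ᵀ T₂ = Compose.result T₁ T₂

-- A cubic Halin tripole is determined by the plane
-- subtree hanging from its root vertex, which is a rooted plane binary tree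
-- (every non-leaf has exactly two ordered children); leaves carry the
-- cycle edges.

trivial : Tripole
trivial = record { nV = 1 ; nE = 0 ; edge = λ () ; semi = λ _ → zero }

data PlaneBinTree : Set where
  leaf : PlaneBinTree
  node : PlaneBinTree → PlaneBinTree → PlaneBinTree

halinTripole : PlaneBinTree → Tripole
halinTripole leaf = trivial
halinTripole (node t₁ t₂) = halinTripole t₁ +ᵀ halinTripole t₂

NonTrivial : Tripole → Set
NonTrivial T = nV T ≢ 1

{-# OPTIONS --safe #-}
-- A total colouring of T₁ + T₂ restricts to total colourings of T₁ and T₂: the edge y₁*x₂*
-- plays the semi-edge y₁ of T₁ and x₂ of T₂, and the edge rᵢ*r* plays rᵢ.  Every item at a
-- vertex of Tᵢ comes from Tᵢ, so the only constraints not already checked inside T₁ and T₂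
-- live on the edge y₁*x₂* and at the new vertex r*, and these are exactly "composable" and
-- "yields" (|{e₁, f₁, c₂, d₂}| = 3 with e₁ = c₂ says f₁ ≠ d₂).  Conversely, colourings of T₁
-- and T₂ meeting these conditions glue to one of T₁ + T₂, with r* coloured b and r coloured a.
-- Nothing about Halin tripoles is used.

module Submission where

open import Defs
open import Data.Nat using (ℕ; zero; suc; _+_; _≤_)
import Data.Nat as ℕ
open import Data.Nat.Properties using (≤-pred)
open import Data.Fin using (Fin; zero; suc; _↑ˡ_; _↑ʳ_; splitAt)
open import Data.Fin.Properties using (_≟_; all?; splitAt-↑ˡ; splitAt-↑ʳ; splitAt⁻¹-↑ˡ; splitAt⁻¹-↑ʳ; ↑ˡ-injective; ↑ʳ-injective; suc-injective)
open import Data.List using (List; []; _∷_; allFin)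
open import Data.List.Properties using (filter-notAll)
import Data.List.Relation.Unary.Any as Any
open import Data.List.Relation.Unary.All using ([]; _∷_)
open import Data.List.Relation.Unary.All.Properties using (All¬⇒¬Any; ¬Any⇒All¬)
open import Data.List.Membership.Propositional using (_∉_)
open import Data.List.Membership.Propositional.Properties using (∈-allFin)
open import Data.List.Membership.DecPropositional (_≟_ {4}) using (_∈?_)
open import Data.Product using (∃; _×_; _,_; proj₁; proj₂; map)
open import Data.Sum using (inj₁; inj₂; [_,_])
import Data.Sum as Sum
open import Data.Empty using (⊥-elim)
open import Function using (_∘_)
open import Function.Definitions using (Injective; StrictlyInverseʳ)
open import Relation.Nullary using (¬?; contradiction)
open import Relation.Nullary.Decidable using (toWitness; _→-dec_)
open import Relation.Binary.PropositionalEquality using (_≡_; _≢_; refl; sym; trans; cong; cong₂; subst; subst₂; ≢-sym)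

∉⇒card≤3 : (c : Color) (l : List Color) → c ∉ l → card l ≤ 3
∉⇒card≤3 c l c∉l =
  ≤-pred (filter-notAll (_∈? l) (allFin 4) (Any.map (λ { refl → c∉l }) (∈-allFin c)))

card[e,f,e,d]≡3 : ∀ (e f d : Color) → e ≢ f → e ≢ d → f ≢ d → card (e ∷ f ∷ e ∷ d ∷ []) ≡ 3
card[e,f,e,d]≡3 = toWitness {a? = all? λ e → all? λ f → all? λ d →
  ¬? (e ≟ f) →-dec ¬? (e ≟ d) →-dec ¬? (f ≟ d) →-dec (card (e ∷ f ∷ e ∷ d ∷ []) ℕ.≟ 3)} _

card[e,f,e,f]≢3 : ∀ (e f : Color) → card (e ∷ f ∷ e ∷ f ∷ []) ≢ 3
card[e,f,e,f]≢3 = toWitness {a? = all? λ e → all? λ f → ¬? (card (e ∷ f ∷ e ∷ f ∷ []) ℕ.≟ 3)} _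

card[e,f,c,d]≡3⇒f≢d : ∀ {e f c d : Color} → e ≡ c → card (e ∷ f ∷ c ∷ d ∷ []) ≡ 3 → f ≢ d
card[e,f,c,d]≡3⇒f≢d {e} {f} refl card≡3 refl = card[e,f,e,f]≢3 e f card≡3

data Split (m n : ℕ) : Fin (m + n) → Set where
  left  : ∀ i → Split m n (i ↑ˡ n)
  right : ∀ j → Split m n (m ↑ʳ j)

split : ∀ m {n} (k : Fin (m + n)) → Split m n k
split m k with splitAt m k in eq
... | inj₁ i = subst (Split m _) (splitAt⁻¹-↑ˡ eq) (left i)
... | inj₂ j = subst (Split m _) (splitAt⁻¹-↑ʳ eq) (right j)

↑ˡ≢↑ʳ : ∀ {m n} (i : Fin m) (j : Fin n) → i ↑ˡ n ≢ m ↑ʳ j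
↑ˡ≢↑ʳ {m} {n} i j eq with trans (sym (splitAt-↑ˡ m i n)) (trans (cong (splitAt m) eq) (splitAt-↑ʳ m n j))
... | ()

strictlyInverseʳ⇒injective : ∀ {A B : Set} {f : A → B} {g : B → A} →
                             StrictlyInverseʳ _≡_ f g → Injective _≡_ _≡_ f
strictlyInverseʳ⇒injective {g = g} g∘f≡id {a} {b} fa≡fb =
  trans (sym (g∘f≡id a)) (trans (cong g fa≡fb) (g∘f≡id b))

boundary∈S : ∀ {T} (φ : TotalColoring T) → InS (boundary φ)
boundary∈S φ = incid-proper φ (inj₂ r) _ refl , incid-proper φ (inj₂ x) _ refl , incid-proper φ (inj₂ y) _ refl

record _↪_ (S U : Tripole) : Set where
  field
    vmap : Fin (nV S) → Fin (nV U)
    imap : Item S → Item U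
    emap : Fin (nE S) → Fin (nE U)
    edge-emap : ∀ j → edge U (emap j) ≡ map vmap vmap (edge S j)
    imap-injective : Injective _≡_ _≡_ imap
    incident-imap : ∀ {a v} → Incident S a v → Incident U (imap a) (vmap v)
open _↪_

restrict : ∀ {S U} → S ↪ U → TotalColoring U → TotalColoring S
restrict ι φ = record
  { vcol = vcol φ ∘ vmap ι
  ; icol = icol φ ∘ imap ι
  ; vertex-proper = λ j →
      subst (λ e → vcol φ (proj₁ e) ≢ vcol φ (proj₂ e)) (edge-emap ι j) (vertex-proper φ (emap ι j))
  ; item-proper = λ a b v a≢b ha hb →
      item-proper φ (imap ι a) (imap ι b) (vmap ι v) (a≢b ∘ imap-injective ι)
        (incident-imap ι ha) (incident-imap ι hb)
  ; incid-proper = λ a v h → incid-proper φ (imap ι a) (vmap ι v) (incident-imap ι h)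
  }

Reflects : ∀ {S U} → S ↪ U → Set
Reflects {S} {U} ι = ∀ {a u} → Incident U a (vmap ι u) → ∃ λ a' → imap ι a' ≡ a × Incident S a' u

module Extension {S U} (ι : S ↪ U) (reflects : Reflects ι) (φ : TotalColoring S)
  (vc : Fin (nV U) → Color) (ic : Item U → Color)
  (vc-vmap : ∀ u → vc (vmap ι u) ≡ vcol φ u) (ic-imap : ∀ a → ic (imap ι a) ≡ icol φ a) where

  vertex-proper-emap : ∀ j → vc (proj₁ (edge U (emap ι j))) ≢ vc (proj₂ (edge U (emap ι j)))
  vertex-proper-emap j rewrite edge-emap ι j =
    subst₂ _≢_ (sym (vc-vmap _)) (sym (vc-vmap _)) (vertex-proper φ j)

  item-proper-vmap : ∀ {a b u} → a ≢ b → Incident U a (vmap ι u) → Incident U b (vmap ι u) → ic a ≢ ic b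
  item-proper-vmap {u = u} a≢b ha hb with reflects ha | reflects hb
  ... | a' , refl , ha' | b' , refl , hb' =
    subst₂ _≢_ (sym (ic-imap a')) (sym (ic-imap b'))
      (item-proper φ a' b' u (a≢b ∘ cong (imap ι)) ha' hb')

  incid-proper-vmap : ∀ {a u} → Incident U a (vmap ι u) → ic a ≢ vc (vmap ι u)
  incid-proper-vmap {u = u} h with reflects h
  ... | a' , refl , h' = subst₂ _≢_ (sym (ic-imap a')) (sym (vc-vmap u)) (incid-proper φ a' u h')

pattern merged-edge = inj₁ zero
pattern root-edge₁ = inj₁ (suc zero)
pattern root-edge₂ = inj₁ (suc (suc zero))
pattern old-edge k = inj₁ (suc (suc (suc k)))

module Composition (T₁ T₂ : Tripole) where
  open Compose T₁ T₂

  T : Tripole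
  T = T₁ +ᵀ T₂

  emb₁-injective : ∀ {u w} → emb₁ u ≡ emb₁ w → u ≡ w
  emb₁-injective = ↑ˡ-injective n₂ _ _ ∘ suc-injective

  emb₂-injective : ∀ {u w} → emb₂ u ≡ emb₂ w → u ≡ w
  emb₂-injective = ↑ʳ-injective n₁ _ _ ∘ suc-injective

  emb₁≢emb₂ : ∀ {u w} → emb₁ u ≢ emb₂ w
  emb₁≢emb₂ = ↑ˡ≢↑ʳ _ _ ∘ suc-injective

  old-↑ˡ : ∀ j → old (j ↑ˡ m₂) ≡ map emb₁ emb₁ (edge T₁ j)
  old-↑ˡ j rewrite splitAt-↑ˡ m₁ j m₂ = refl

  old-↑ʳ : ∀ j → old (m₁ ↑ʳ j) ≡ map emb₂ emb₂ (edge T₂ j)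
  old-↑ʳ j rewrite splitAt-↑ʳ m₁ m₂ j = refl

  data VertexView : Fin (nV T) → Set where
    root : VertexView zero
    in₁  : ∀ u → VertexView (emb₁ u)
    in₂  : ∀ u → VertexView (emb₂ u)

  vertexView : ∀ v → VertexView v
  vertexView zero = root
  vertexView (suc w) with split n₁ w
  ... | left u  = in₁ u
  ... | right u = in₂ u

  ι₁ : Item T₁ → Item T
  ι₁ (inj₁ j) = old-edge (j ↑ˡ m₂)
  ι₁ (inj₂ r) = root-edge₁
  ι₁ (inj₂ x) = inj₂ x
  ι₁ (inj₂ y) = merged-edge

  ι₂ : Item T₂ → Item T
  ι₂ (inj₁ j) = old-edge (m₁ ↑ʳ j)
  ι₂ (inj₂ r) = root-edge₂
  ι₂ (inj₂ x) = merged-edge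
  ι₂ (inj₂ y) = inj₂ y

  -- left inverses of ι₁ and ι₂; their values off the images are arbitrary
  ι₁⁻¹ : Item T → Item T₁
  ι₁⁻¹ merged-edge = inj₂ y
  ι₁⁻¹ root-edge₁ = inj₂ r
  ι₁⁻¹ (old-edge k) = [ inj₁ , (λ _ → inj₂ r) ] (splitAt m₁ k)
  ι₁⁻¹ _ = inj₂ x

  ι₂⁻¹ : Item T → Item T₂
  ι₂⁻¹ merged-edge = inj₂ x
  ι₂⁻¹ root-edge₂ = inj₂ r
  ι₂⁻¹ (old-edge k) = [ (λ _ → inj₂ r) , inj₁ ] (splitAt m₁ k)
  ι₂⁻¹ _ = inj₂ y

  ι₁⁻¹∘ι₁ : ∀ a → ι₁⁻¹ (ι₁ a) ≡ a
  ι₁⁻¹∘ι₁ (inj₁ j) = cong [ inj₁ , (λ _ → inj₂ r) ] (splitAt-↑ˡ m₁ j m₂)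
  ι₁⁻¹∘ι₁ (inj₂ r) = refl
  ι₁⁻¹∘ι₁ (inj₂ x) = refl
  ι₁⁻¹∘ι₁ (inj₂ y) = refl

  ι₂⁻¹∘ι₂ : ∀ a → ι₂⁻¹ (ι₂ a) ≡ a
  ι₂⁻¹∘ι₂ (inj₁ j) = cong [ (λ _ → inj₂ r) , inj₁ ] (splitAt-↑ʳ m₁ m₂ j)
  ι₂⁻¹∘ι₂ (inj₂ r) = refl
  ι₂⁻¹∘ι₂ (inj₂ x) = refl
  ι₂⁻¹∘ι₂ (inj₂ y) = refl

  incident-ι₁ : ∀ {a v} → Incident T₁ a v → Incident T (ι₁ a) (emb₁ v)
  incident-ι₁ {inj₁ j} h rewrite old-↑ˡ j = Sum.map (cong emb₁) (cong emb₁) h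
  incident-ι₁ {inj₂ r} h = inj₁ (cong emb₁ h)
  incident-ι₁ {inj₂ x} h = cong emb₁ h
  incident-ι₁ {inj₂ y} h = inj₁ (cong emb₁ h)

  incident-ι₂ : ∀ {a v} → Incident T₂ a v → Incident T (ι₂ a) (emb₂ v)
  incident-ι₂ {inj₁ j} h rewrite old-↑ʳ j = Sum.map (cong emb₂) (cong emb₂) h
  incident-ι₂ {inj₂ r} h = inj₁ (cong emb₂ h)
  incident-ι₂ {inj₂ x} h = inj₂ (cong emb₂ h)
  incident-ι₂ {inj₂ y} h = cong emb₂ h

  embed₁ : T₁ ↪ T
  embed₁ = record
    { vmap = emb₁ ; imap = ι₁ ; emap = λ j → suc (suc (suc (j ↑ˡ m₂)))
    ; edge-emap = old-↑ˡ
    ; imap-injective = strictlyInverseʳ⇒injective {g = ι₁⁻¹} ι₁⁻¹∘ι₁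
    ; incident-imap = incident-ι₁
    }

  embed₂ : T₂ ↪ T
  embed₂ = record
    { vmap = emb₂ ; imap = ι₂ ; emap = λ j → suc (suc (suc (m₁ ↑ʳ j)))
    ; edge-emap = old-↑ʳ
    ; imap-injective = strictlyInverseʳ⇒injective {g = ι₂⁻¹} ι₂⁻¹∘ι₂
    ; incident-imap = incident-ι₂
    }

  reflects₁ : Reflects embed₁
  reflects₁ {merged-edge} (inj₁ h) = inj₂ y , refl , emb₁-injective h
  reflects₁ {merged-edge} (inj₂ h) = ⊥-elim (emb₁≢emb₂ (sym h))
  reflects₁ {root-edge₁} (inj₁ h) = inj₂ r , refl , emb₁-injective h
  reflects₁ {root-edge₂} (inj₁ h) = ⊥-elim (emb₁≢emb₂ (sym h))
  reflects₁ {old-edge k} h with split m₁ k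
  reflects₁ {old-edge .(j ↑ˡ m₂)} h | left j rewrite old-↑ˡ j =
    inj₁ j , refl , Sum.map emb₁-injective emb₁-injective h
  reflects₁ {old-edge .(m₁ ↑ʳ j)} h | right j rewrite old-↑ʳ j =
    ⊥-elim ([ emb₁≢emb₂ ∘ sym , emb₁≢emb₂ ∘ sym ] h)
  reflects₁ {inj₂ x} h = inj₂ x , refl , emb₁-injective h
  reflects₁ {inj₂ y} h = ⊥-elim (emb₁≢emb₂ (sym h))

  reflects₂ : Reflects embed₂
  reflects₂ {merged-edge} (inj₁ h) = ⊥-elim (emb₁≢emb₂ h)
  reflects₂ {merged-edge} (inj₂ h) = inj₂ x , refl , emb₂-injective h
  reflects₂ {root-edge₁} (inj₁ h) = ⊥-elim (emb₁≢emb₂ h)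
  reflects₂ {root-edge₂} (inj₁ h) = inj₂ r , refl , emb₂-injective h
  reflects₂ {old-edge k} h with split m₁ k
  reflects₂ {old-edge .(j ↑ˡ m₂)} h | left j rewrite old-↑ˡ j =
    ⊥-elim ([ emb₁≢emb₂ , emb₁≢emb₂ ] h)
  reflects₂ {old-edge .(m₁ ↑ʳ j)} h | right j rewrite old-↑ʳ j =
    inj₁ j , refl , Sum.map emb₂-injective emb₂-injective h
  reflects₂ {inj₂ x} h = ⊥-elim (emb₁≢emb₂ h)
  reflects₂ {inj₂ y} h = inj₂ y , refl , emb₂-injective h

  data AtRoot : Item T → Set where
    via₁   : AtRoot root-edge₁
    via₂   : AtRoot root-edge₂
    semi-r : AtRoot (inj₂ r)

  incident-root : ∀ {a} → Incident T a zero → AtRoot a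
  incident-root {merged-edge} (inj₁ ())
  incident-root {merged-edge} (inj₂ ())
  incident-root {root-edge₁} _ = via₁
  incident-root {root-edge₂} _ = via₂
  incident-root {old-edge k} h with split m₁ k
  incident-root {old-edge .(j ↑ˡ m₂)} h | left j rewrite old-↑ˡ j = [ (λ ()) , (λ ()) ] h
  incident-root {old-edge .(m₁ ↑ʳ j)} h | right j rewrite old-↑ʳ j = [ (λ ()) , (λ ()) ] h
  incident-root {inj₂ r} _ = semi-r

  module Restriction (φ : TotalColoring T) where
    ψ₁ : TotalColoring T₁
    ψ₁ = restrict embed₁ φ

    ψ₂ : TotalColoring T₂
    ψ₂ = restrict embed₂ φ

    root-colour-fresh : vcol φ zero ∉ (icol φ root-edge₁ ∷ vcol φ (emb₁ (semi T₁ r)) ∷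
                                       icol φ root-edge₂ ∷ vcol φ (emb₂ (semi T₂ r)) ∷ [])
    root-colour-fresh = All¬⇒¬Any
      (≢-sym (incid-proper φ root-edge₁ zero (inj₂ refl)) ∷ ≢-sym (vertex-proper φ (suc zero)) ∷
       ≢-sym (incid-proper φ root-edge₂ zero (inj₂ refl)) ∷ ≢-sym (vertex-proper φ (suc (suc zero))) ∷ [])

    root-semi-colour-fresh : icol φ (inj₂ r) ∉ (vcol φ zero ∷ icol φ root-edge₁ ∷ icol φ root-edge₂ ∷ [])
    root-semi-colour-fresh = All¬⇒¬Any
      (incid-proper φ (inj₂ r) zero refl ∷
       item-proper φ (inj₂ r) root-edge₁ zero (λ ()) refl (inj₂ refl) ∷
       item-proper φ (inj₂ r) root-edge₂ zero (λ ()) refl (inj₂ refl) ∷ [])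

    restrictions-composable : Composable (boundary ψ₁) (boundary ψ₂)
    restrictions-composable =
      refl ,
      card[e,f,e,d]≡3 _ _ _ (incid-proper φ merged-edge _ (inj₁ refl))
                            (incid-proper φ merged-edge _ (inj₂ refl)) (vertex-proper φ zero) ,
      item-proper φ root-edge₁ root-edge₂ zero (λ ()) (inj₂ refl) (inj₂ refl) ,
      ∉⇒card≤3 (vcol φ zero) _ root-colour-fresh

    restrictions-yield : Yields (boundary ψ₁) (boundary ψ₂) (boundary φ)
    restrictions-yield = refl , refl , refl , refl , root-colour-fresh , root-semi-colour-fresh

  module Glue (φ₁ : TotalColoring T₁) (φ₂ : TotalColoring T₂) (a b : Color)
    (merged : icol φ₁ (inj₂ y) ≡ icol φ₂ (inj₂ x))
    (f₁≢d₂ : vcol φ₁ (semi T₁ y) ≢ vcol φ₂ (semi T₂ x))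
    (a₁≢a₂ : icol φ₁ (inj₂ r) ≢ icol φ₂ (inj₂ r))
    (b≢a₁ : b ≢ icol φ₁ (inj₂ r)) (b≢b₁ : b ≢ vcol φ₁ (semi T₁ r))
    (b≢a₂ : b ≢ icol φ₂ (inj₂ r)) (b≢b₂ : b ≢ vcol φ₂ (semi T₂ r))
    (a≢b : a ≢ b) (a≢a₁ : a ≢ icol φ₁ (inj₂ r)) (a≢a₂ : a ≢ icol φ₂ (inj₂ r)) where

    vcolT : Fin (nV T) → Color
    vcolT zero = b
    vcolT (suc w) = [ vcol φ₁ , vcol φ₂ ] (splitAt n₁ w)

    icolT : Item T → Color
    icolT merged-edge = icol φ₁ (inj₂ y)
    icolT root-edge₁ = icol φ₁ (inj₂ r)
    icolT root-edge₂ = icol φ₂ (inj₂ r)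
    icolT (old-edge k) = [ icol φ₁ ∘ inj₁ , icol φ₂ ∘ inj₁ ] (splitAt m₁ k)
    icolT (inj₂ r) = a
    icolT (inj₂ x) = icol φ₁ (inj₂ x)
    icolT (inj₂ y) = icol φ₂ (inj₂ y)

    vcolT-emb₁ : ∀ u → vcolT (emb₁ u) ≡ vcol φ₁ u
    vcolT-emb₁ u = cong [ vcol φ₁ , vcol φ₂ ] (splitAt-↑ˡ n₁ u n₂)

    vcolT-emb₂ : ∀ u → vcolT (emb₂ u) ≡ vcol φ₂ u
    vcolT-emb₂ u = cong [ vcol φ₁ , vcol φ₂ ] (splitAt-↑ʳ n₁ n₂ u)

    icolT-ι₁ : ∀ p → icolT (ι₁ p) ≡ icol φ₁ p
    icolT-ι₁ (inj₁ j) = cong [ icol φ₁ ∘ inj₁ , icol φ₂ ∘ inj₁ ] (splitAt-↑ˡ m₁ j m₂)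
    icolT-ι₁ (inj₂ r) = refl
    icolT-ι₁ (inj₂ x) = refl
    icolT-ι₁ (inj₂ y) = refl

    icolT-ι₂ : ∀ p → icolT (ι₂ p) ≡ icol φ₂ p
    icolT-ι₂ (inj₁ j) = cong [ icol φ₁ ∘ inj₁ , icol φ₂ ∘ inj₁ ] (splitAt-↑ʳ m₁ m₂ j)
    icolT-ι₂ (inj₂ r) = refl
    icolT-ι₂ (inj₂ x) = merged
    icolT-ι₂ (inj₂ y) = refl

    module Ext₁ = Extension embed₁ reflects₁ φ₁ vcolT icolT vcolT-emb₁ icolT-ι₁
    module Ext₂ = Extension embed₂ reflects₂ φ₂ vcolT icolT vcolT-emb₂ icolT-ι₂

    vertex-proper-glued : ∀ i → vcolT (proj₁ (edge T i)) ≢ vcolT (proj₂ (edge T i))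
    vertex-proper-glued zero = subst₂ _≢_ (sym (vcolT-emb₁ _)) (sym (vcolT-emb₂ _)) f₁≢d₂
    vertex-proper-glued (suc zero) = subst₂ _≢_ (sym (vcolT-emb₁ _)) refl (≢-sym b≢b₁)
    vertex-proper-glued (suc (suc zero)) = subst₂ _≢_ (sym (vcolT-emb₂ _)) refl (≢-sym b≢b₂)
    vertex-proper-glued (suc (suc (suc k))) with split m₁ k
    ... | left j  = Ext₁.vertex-proper-emap j
    ... | right j = Ext₂.vertex-proper-emap j

    item-proper-root : ∀ {p q} → AtRoot p → AtRoot q → p ≢ q → icolT p ≢ icolT q
    item-proper-root via₁   via₁   p≢q = contradiction refl p≢q
    item-proper-root via₁   via₂   _   = a₁≢a₂
    item-proper-root via₁   semi-r _   = ≢-sym a≢a₁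
    item-proper-root via₂   via₁   _   = ≢-sym a₁≢a₂
    item-proper-root via₂   via₂   p≢q = contradiction refl p≢q
    item-proper-root via₂   semi-r _   = ≢-sym a≢a₂
    item-proper-root semi-r via₁   _   = a≢a₁
    item-proper-root semi-r via₂   _   = a≢a₂
    item-proper-root semi-r semi-r p≢q = contradiction refl p≢q

    incid-proper-root : ∀ {p} → AtRoot p → icolT p ≢ b
    incid-proper-root via₁   = ≢-sym b≢a₁
    incid-proper-root via₂   = ≢-sym b≢a₂
    incid-proper-root semi-r = a≢b

    item-proper-glued : ∀ p q v → p ≢ q → Incident T p v → Incident T q v → icolT p ≢ icolT q
    item-proper-glued p q v p≢q hp hq with vertexView v
    ... | root  = item-proper-root (incident-root hp) (incident-root hq) p≢q
    ... | in₁ _ = Ext₁.item-proper-vmap p≢q hp hq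
    ... | in₂ _ = Ext₂.item-proper-vmap p≢q hp hq

    incid-proper-glued : ∀ p v → Incident T p v → icolT p ≢ vcolT v
    incid-proper-glued p v hp with vertexView v
    ... | root  = incid-proper-root (incident-root hp)
    ... | in₁ _ = Ext₁.incid-proper-vmap hp
    ... | in₂ _ = Ext₂.incid-proper-vmap hp

    glued : TotalColoring T
    glued = record
      { vcol = vcolT
      ; icol = icolT
      ; vertex-proper = vertex-proper-glued
      ; item-proper = item-proper-glued
      ; incid-proper = incid-proper-glued
      }

    boundary-glued : boundary glued ≡ sext a b (icol φ₁ (inj₂ x)) (vcol φ₁ (semi T₁ x))
                                               (icol φ₂ (inj₂ y)) (vcol φ₂ (semi T₂ y))
    boundary-glued = cong₂ (λ d f → sext a b (icol φ₁ (inj₂ x)) d (icol φ₂ (inj₂ y)) f)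
                           (vcolT-emb₁ _) (vcolT-emb₂ _)

  palette-restrict : ∀ {s} → Palette T s → (Palette T₁ ⊕ Palette T₂) s
  palette-restrict (φ , refl) =
    boundary ψ₁ , boundary ψ₂ , (ψ₁ , refl) , (ψ₂ , refl) , boundary∈S ψ₁ , boundary∈S ψ₂ ,
    restrictions-composable , boundary∈S φ , restrictions-yield
    where open Restriction φ

  palette-glue : ∀ {s} → (Palette T₁ ⊕ Palette T₂) s → Palette T s
  palette-glue {sext a b _ _ _ _}
    (_ , _ , (φ₁ , refl) , (φ₂ , refl) , _ , _ , (merged , card≡3 , a₁≢a₂ , _) , _ ,
     (refl , refl , refl , refl , b∉ , a∉))
    with ¬Any⇒All¬ _ b∉ | ¬Any⇒All¬ _ a∉
  ... | b≢a₁ ∷ b≢b₁ ∷ b≢a₂ ∷ b≢b₂ ∷ [] | a≢b ∷ a≢a₁ ∷ a≢a₂ ∷ [] = glued , boundary-glued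
    where open Glue φ₁ φ₂ a b merged (card[e,f,c,d]≡3⇒f≢d merged card≡3) a₁≢a₂
                    b≢a₁ b≢b₁ b≢a₂ b≢b₂ a≢b a≢a₁ a≢a₂

palette-+ᵀ : (T₁ T₂ : Tripole) → Palette (T₁ +ᵀ T₂) ≐ (Palette T₁ ⊕ Palette T₂)
palette-+ᵀ T₁ T₂ _ = palette-restrict , palette-glue
  where open Composition T₁ T₂

lemma3 : (t₁ t₂ : PlaneBinTree) →
    let T₁ = halinTripole t₁
        T₂ = halinTripole t₂
    in Palette (T₁ +ᵀ T₂) ≐ (Palette T₁ ⊕ Palette T₂)
lemma3 t₁ t₂ = palette-+ᵀ (halinTripole t₁) (halinTripole t₂)
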